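{- There exists an algorithm that computes, for a given $+$-free $\sharp\mathsf{PP}$-formula $\phi$, a logically equivalent $\sharp\mathsf{PP}$-formula $\phi'=\psi_1\times\psi_2$ where $\psi_1$ is constant and $\psi_2$ is basic, such that $\mathsf{width}(\phi')\le\mathsf{width}(\phi)$.
   Context: pp-formulas are built from atoms with $\wedge,\exists$ over a relational signature (no equality). $\sharp$-formulas: inductively, with free and closed variable sets: $C(\phi,L)$ ($\phi$ first-order, $L\supseteq\mathrm{free}(\phi)$; free $L$, closed $\emptyset$); $PV\psi$ ($V\cap\mathrm{closed}(\psi)=\emptyset$; free $\mathrm{free}(\psi)\setminus V$, closed $V\cup\mathrm{closed}(\psi)$); $EV\psi$ ($V$ disjoint from free and closed variables of $\psi$; free $V\cup\mathrm{free}(\psi)$, closed $\mathrm{closed}(\psi)$); $\psi\times\psi'$ (equal free sets, disjoint closed sets; closed the union); $\psi+\psi'$ (equal free sets; closed the union); $n\in\mathbb{Z}$. Semantics for finite $\mathbf{B}$ and $h:\mathrm{free}\to B$: $[\mathbf{B},C(\phi,L)](h)=1$ if $\mathbf{B},h\models\phi$, else $0$; $[\mathbf{B},PV\psi](h)=\sum[\mathbf{B},\psi](h')$ over extensions $h'$ of $h$ to $\mathrm{free}(\psi)\cup V$; $[\mathbf{B},EV\psi](h)=[\mathbf{B},\psi](h|_{\mathrm{free}(\psi)})$; $\times,+$ pointwise; $[\mathbf{B},n](h)=n$. Logical equivalence: same free variables and equal $[\mathbf{B},\cdot]$ for every structure. $\mathsf{width}$ = max of $|\mathrm{free}(\theta)|$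 over $\sharp$-subformulas (subtrees) and fo-subformulas (subformulas of $\phi$ occurring as $C(\phi,L)$). $\sharp\mathsf{PP}$: every $C(\phi,L)$ has $\phi$ a pp-formula. $+$-free: contains no $+$. Basic: contains no $+$ and no subformula $n\in\mathbb{Z}$. Constant: built only from integer constants, $\times$, and $P$- and $E$-quantifiers. -}

module Defs where

open import Data.Bool using (Bool; true; false; if_then_else_; not; _∧_; _∨_)
open import Data.Nat using (ℕ; zero; suc; _≡ᵇ_; _⊔_)
open import Data.Nat.Properties using (_≟_)
open import Data.Fin using (Fin)
open import Data.Integer using (ℤ; 0ℤ; 1ℤ; _+_)
open import Data.List using (List; []; _∷_; _++_; map; foldr; length; allFin; filterᵇ; deduplicate)
open import Data.List.Relation.Binary.Subset.Propositional using (_⊆_)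
open import Data.List.Relation.Binary.Disjoint.Propositional using (Disjoint)
open import Data.Bool.ListAction using (any; all)
open import Data.Vec using (Vec; toList)
import Data.Vec as Vec
open import Data.Product using (_×_; _,_)
open import Data.Unit using (⊤)
open import Data.Empty using (⊥)
open import Relation.Binary.PropositionalEquality using (_≡_)

record Signature : Set₁ where
  field
    Sym : Set
    ar  : Sym → ℕ

-- Variables are natural numbers; finite variable sets are lists
-- (read up to membership; duplicates are irrelevant).
Var : Set
Var = ℕ

VarSet : Set
VarSet = List Var

_≐_ : VarSet → VarSet → Set
A ≐ B = (A ⊆ B) × (B ⊆ A)

remove : Var → VarSet → VarSet
remove x = filterᵇ (λ y → not (y ≡ᵇ x))

minus : VarSet → VarSet → VarSet
minus A []      = A
minus A (v ∷ V) = minus (remove v A) V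

card : VarSet → ℕ
card A = length (deduplicate _≟_ A)

-- A finite structure with (nonempty) universe Fin (suc n).
record Structure (S : Signature) (n : ℕ) : Set where
  open Signature S
  field
    rel : (R : Sym) → Vec (Fin (suc n)) (ar R) → Bool

-- Assignments (total; only values on free variables matter).
Assign : ℕ → Set
Assign n = Var → Fin (suc n)

update : ∀ {n} → Assign n → Var → Fin (suc n) → Assign n
update h x b y = if y ≡ᵇ x then b else h y

sumℤ : List ℤ → ℤ
sumℤ = foldr _+_ 0ℤ

module _ (S : Signature) where
  open Signature S

  data FO : Set where
    atom  : (R : Sym) → Vec Var (ar R) → FO
    true′ : FO
    ¬′_   : FO → FO
    _∧′_  : FO → FO → FO
    _∨′_  : FO → FO → FO
    ∃′    : Var → FO → FO
    ∀′    : Var → FO → FO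

  data SF : Set where
    C   : FO → VarSet → SF
    P   : VarSet → SF → SF
    E   : VarSet → SF → SF
    _⊗_ : SF → SF → SF
    _⊕_ : SF → SF → SF
    K   : ℤ → SF

module _ {S : Signature} where
  open Signature S

  fvFO : FO S → VarSet
  fvFO (atom R xs) = toList xs
  fvFO true′       = []
  fvFO (¬′ φ)      = fvFO φ
  fvFO (φ ∧′ ψ)    = fvFO φ ++ fvFO ψ
  fvFO (φ ∨′ ψ)    = fvFO φ ++ fvFO ψ
  fvFO (∃′ x φ)    = remove x (fvFO φ)
  fvFO (∀′ x φ)    = remove x (fvFO φ)

  -- satisfaction B, h ⊨ φ (decidable: finite universe)
  sat : ∀ {n} → Structure S n → Assign n → FO S → Bool
  sat B h (atom R xs) = Structure.rel B R (Vec.map h xs)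
  sat B h true′       = true
  sat B h (¬′ φ)      = not (sat B h φ)
  sat B h (φ ∧′ ψ)    = sat B h φ ∧ sat B h ψ
  sat B h (φ ∨′ ψ)    = sat B h φ ∨ sat B h ψ
  sat {n} B h (∃′ x φ) = any (λ b → sat B (update h x b) φ) (allFin (suc n))
  sat {n} B h (∀′ x φ) = all (λ b → sat B (update h x b) φ) (allFin (suc n))

  IsPP : FO S → Set
  IsPP (atom R xs) = ⊤
  IsPP true′       = ⊤
  IsPP (¬′ φ)      = ⊥
  IsPP (φ ∧′ ψ)    = IsPP φ × IsPP ψ
  IsPP (φ ∨′ ψ)    = ⊥
  IsPP (∃′ x φ)    = IsPP φ
  IsPP (∀′ x φ)    = ⊥

  widthFO : FO S → ℕ
  widthFO φ@(atom R xs) = card (fvFO φ)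
  widthFO φ@true′       = card (fvFO φ)
  widthFO φ@(¬′ ψ)      = card (fvFO φ) ⊔ widthFO ψ
  widthFO φ@(ψ ∧′ χ)    = card (fvFO φ) ⊔ (widthFO ψ ⊔ widthFO χ)
  widthFO φ@(ψ ∨′ χ)    = card (fvFO φ) ⊔ (widthFO ψ ⊔ widthFO χ)
  widthFO φ@(∃′ x ψ)    = card (fvFO φ) ⊔ widthFO ψ
  widthFO φ@(∀′ x ψ)    = card (fvFO φ) ⊔ widthFO ψ

  free : SF S → VarSet
  free (C φ L)  = L
  free (P V ψ)  = minus (free ψ) V
  free (E V ψ)  = V ++ free ψ
  free (ψ ⊗ χ)  = free ψ
  free (ψ ⊕ χ)  = free ψ
  free (K m)    = []

  closed : SF S → VarSet
  closed (C φ L)  = []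
  closed (P V ψ)  = V ++ closed ψ
  closed (E V ψ)  = closed ψ
  closed (ψ ⊗ χ)  = closed ψ ++ closed χ
  closed (ψ ⊕ χ)  = closed ψ ++ closed χ
  closed (K m)    = []

  -- the side conditions of the inductive definition of ♯-formulas
  WF : SF S → Set
  WF (C φ L)  = fvFO φ ⊆ L
  WF (P V ψ)  = WF ψ × Disjoint V (closed ψ)
  WF (E V ψ)  = WF ψ × Disjoint V (free ψ) × Disjoint V (closed ψ)
  WF (ψ ⊗ χ)  = WF ψ × WF χ × (free ψ ≐ free χ) × Disjoint (closed ψ) (closed χ)
  WF (ψ ⊕ χ)  = WF ψ × WF χ × (free ψ ≐ free χ)
  WF (K m)    = ⊤

  -- Σ over all extensions of h to the variables in the (duplicate-free) list
  sumOver : ∀ {n} → VarSet → (Assign n → ℤ) → Assign n → ℤ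
  sumOver []       f h = f h
  sumOver {n} (x ∷ V) f h = sumℤ (map (λ b → sumOver V f (update h x b)) (allFin (suc n)))

  eval : ∀ {n} → Structure S n → Assign n → SF S → ℤ
  eval B h (C φ L) = if sat B h φ then 1ℤ else 0ℤ
  eval B h (P V ψ) = sumOver (deduplicate _≟_ V) (λ h′ → eval B h′ ψ) h
  eval B h (E V ψ) = eval B h ψ
  eval B h (ψ ⊗ χ) = eval B h ψ Data.Integer.* eval B h χ
  eval B h (ψ ⊕ χ) = eval B h ψ + eval B h χ
  eval B h (K m)   = m

  LogEquiv : SF S → SF S → Set
  LogEquiv ψ χ = (free ψ ≐ free χ)
    × (∀ n (B : Structure S n) (h : Assign n) → eval B h ψ ≡ eval B h χ)

  width : SF S → ℕ
  width ψ@(C φ L)  = card (free ψ) ⊔ widthFO φ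
  width ψ@(P V χ)  = card (free ψ) ⊔ width χ
  width ψ@(E V χ)  = card (free ψ) ⊔ width χ
  width ψ@(χ ⊗ ρ)  = card (free ψ) ⊔ (width χ ⊔ width ρ)
  width ψ@(χ ⊕ ρ)  = card (free ψ) ⊔ (width χ ⊔ width ρ)
  width ψ@(K m)    = card (free ψ)

  SharpPP : SF S → Set
  SharpPP (C φ L)  = IsPP φ
  SharpPP (P V ψ)  = SharpPP ψ
  SharpPP (E V ψ)  = SharpPP ψ
  SharpPP (ψ ⊗ χ)  = SharpPP ψ × SharpPP χ
  SharpPP (ψ ⊕ χ)  = SharpPP ψ × SharpPP χ
  SharpPP (K m)    = ⊤

  PlusFree : SF S → Set
  PlusFree (C φ L)  = ⊤
  PlusFree (P V ψ)  = PlusFree ψ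
  PlusFree (E V ψ)  = PlusFree ψ
  PlusFree (ψ ⊗ χ)  = PlusFree ψ × PlusFree χ
  PlusFree (ψ ⊕ χ)  = ⊥
  PlusFree (K m)    = ⊤

  Basic : SF S → Set
  Basic (C φ L)  = ⊤
  Basic (P V ψ)  = Basic ψ
  Basic (E V ψ)  = Basic ψ
  Basic (ψ ⊗ χ)  = Basic ψ × Basic χ
  Basic (ψ ⊕ χ)  = ⊥
  Basic (K m)    = ⊥

  Constant : SF S → Set
  Constant (C φ L)  = ⊥
  Constant (P V ψ)  = Constant ψ
  Constant (E V ψ)  = Constant ψ
  Constant (ψ ⊗ χ)  = Constant ψ × Constant χ
  Constant (ψ ⊕ χ)  = ⊥
  Constant (K m)    = ⊤

-- Replacing every constant by the trivially true leaf C(⊤, ∅)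
-- gives a basic formula, and the formula factors as (product of the constants) × that
-- basic formula: products are commutative and associative, E does not change values,
-- and P sums over extensions, which commutes with multiplication by a constant.
-- The constant is attached to the free variables of φ by an E-quantifier, so neither
-- the free variables nor the width grow.
module Submission where

open import Defs
open import Data.Nat using (_≤_; z≤n)
open import Data.Nat.Properties using (_≟_; ≤-refl; m≤m⊔n; ⊔-lub)
open import Data.Integer using (ℤ; 1ℤ; _+_; _*_)
open import Data.Integer.Properties
  using (*-zeroʳ; *-identityˡ; *-identityʳ; *-distribˡ-+; *-commutativeSemigroup)
open import Algebra.Properties.CommutativeSemigroup *-commutativeSemigroup using (interchange)
open import Data.List using (List; []; _∷_; _++_; map; allFin; deduplicate)
open import Data.List.Properties using (map-cong; ++-identityʳ)
open import Data.Product using (Σ; _×_; _,_)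
open import Data.Unit using (tt)
open import Relation.Binary.PropositionalEquality using (_≡_; refl; sym; trans; cong; cong₂)
open Relation.Binary.PropositionalEquality.≡-Reasoning

≐-refl : (A : VarSet) → A ≐ A
≐-refl A = (λ x∈A → x∈A) , (λ x∈A → x∈A)

sumℤ-map-*ˡ : ∀ {A : Set} (c : ℤ) (f : A → ℤ) (xs : List A) →
  sumℤ (map (λ a → c * f a) xs) ≡ c * sumℤ (map f xs)
sumℤ-map-*ˡ c f []       = sym (*-zeroʳ c)
sumℤ-map-*ˡ c f (x ∷ xs) = begin
  c * f x + sumℤ (map (λ a → c * f a) xs) ≡⟨ cong (c * f x +_) (sumℤ-map-*ˡ c f xs) ⟩
  c * f x + c * sumℤ (map f xs)           ≡⟨ sym (*-distribˡ-+ c (f x) _) ⟩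
  c * sumℤ (map f (x ∷ xs))               ∎

module _ {S : Signature} where

  sumOver-*ˡ : ∀ {n} (V : VarSet) (c : ℤ) (f g : Assign n → ℤ) →
    (∀ h → f h ≡ c * g h) → ∀ h → sumOver {S = S} V f h ≡ c * sumOver {S = S} V g h
  sumOver-*ˡ []      c f g f≡cg h = f≡cg h
  sumOver-*ˡ (x ∷ V) c f g f≡cg h = trans
    (cong sumℤ (map-cong (λ b → sumOver-*ˡ V c f g f≡cg (update h x b)) (allFin _)))
    (sumℤ-map-*ˡ c (λ b → sumOver {S = S} V g (update h x b)) (allFin _))

  -- Sums are left untouched: the construction is only meant for +-free formulas.
  dropConstants : SF S → SF S
  dropConstants (C φ L) = C φ L
  dropConstants (P V ψ) = P V (dropConstants ψ)
  dropConstants (E V ψ) = E V (dropConstants ψ)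
  dropConstants (ψ ⊗ χ) = dropConstants ψ ⊗ dropConstants χ
  dropConstants (ψ ⊕ χ) = ψ ⊕ χ
  dropConstants (K m)   = C true′ []

  constantFactor : SF S → ℤ
  constantFactor (C φ L) = 1ℤ
  constantFactor (P V ψ) = constantFactor ψ
  constantFactor (E V ψ) = constantFactor ψ
  constantFactor (ψ ⊗ χ) = constantFactor ψ * constantFactor χ
  constantFactor (ψ ⊕ χ) = 1ℤ
  constantFactor (K m)   = m

  free-dropConstants : ∀ ψ → free (dropConstants ψ) ≡ free ψ
  free-dropConstants (C φ L) = refl
  free-dropConstants (P V ψ) = cong (λ A → minus A V) (free-dropConstants ψ)
  free-dropConstants (E V ψ) = cong (V ++_) (free-dropConstants ψ)
  free-dropConstants (ψ ⊗ χ) = free-dropConstants ψ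
  free-dropConstants (ψ ⊕ χ) = refl
  free-dropConstants (K m)   = refl

  closed-dropConstants : ∀ ψ → closed (dropConstants ψ) ≡ closed ψ
  closed-dropConstants (C φ L) = refl
  closed-dropConstants (P V ψ) = cong (V ++_) (closed-dropConstants ψ)
  closed-dropConstants (E V ψ) = closed-dropConstants ψ
  closed-dropConstants (ψ ⊗ χ) = cong₂ _++_ (closed-dropConstants ψ) (closed-dropConstants χ)
  closed-dropConstants (ψ ⊕ χ) = refl
  closed-dropConstants (K m)   = refl

  width-dropConstants : ∀ ψ → width (dropConstants ψ) ≡ width ψ
  width-dropConstants (C φ L) = refl
  width-dropConstants (P V ψ)
    rewrite free-dropConstants ψ | width-dropConstants ψ = refl
  width-dropConstants (E V ψ)
    rewrite free-dropConstants ψ | width-dropConstants ψ = refl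
  width-dropConstants (ψ ⊗ χ)
    rewrite free-dropConstants ψ | width-dropConstants ψ | width-dropConstants χ = refl
  width-dropConstants (ψ ⊕ χ) = refl
  width-dropConstants (K m)   = refl

  WF-dropConstants : ∀ ψ → WF ψ → WF (dropConstants ψ)
  WF-dropConstants (C φ L) wf = wf
  WF-dropConstants (P V ψ) (wf , V#closed)
    rewrite closed-dropConstants ψ = WF-dropConstants ψ wf , V#closed
  WF-dropConstants (E V ψ) (wf , V#free , V#closed)
    rewrite free-dropConstants ψ | closed-dropConstants ψ =
      WF-dropConstants ψ wf , V#free , V#closed
  WF-dropConstants (ψ ⊗ χ) (wfψ , wfχ , free≐ , closed#)
    rewrite free-dropConstants ψ | free-dropConstants χ
          | closed-dropConstants ψ | closed-dropConstants χ =
      WF-dropConstants ψ wfψ , WF-dropConstants χ wfχ , free≐ , closed#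
  WF-dropConstants (ψ ⊕ χ) wf = wf
  WF-dropConstants (K m)   _  = λ ()

  SharpPP-dropConstants : ∀ ψ → SharpPP ψ → SharpPP (dropConstants ψ)
  SharpPP-dropConstants (C φ L) pp        = pp
  SharpPP-dropConstants (P V ψ) pp        = SharpPP-dropConstants ψ pp
  SharpPP-dropConstants (E V ψ) pp        = SharpPP-dropConstants ψ pp
  SharpPP-dropConstants (ψ ⊗ χ) (pp , qq) = SharpPP-dropConstants ψ pp , SharpPP-dropConstants χ qq
  SharpPP-dropConstants (ψ ⊕ χ) pp        = pp
  SharpPP-dropConstants (K m)   _         = tt

  PlusFree⇒Basic-dropConstants : ∀ ψ → PlusFree ψ → Basic (dropConstants ψ)
  PlusFree⇒Basic-dropConstants (C φ L) _         = tt
  PlusFree⇒Basic-dropConstants (P V ψ) pf        = PlusFree⇒Basic-dropConstants ψ pf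
  PlusFree⇒Basic-dropConstants (E V ψ) pf        = PlusFree⇒Basic-dropConstants ψ pf
  PlusFree⇒Basic-dropConstants (ψ ⊗ χ) (pf , qf) =
    PlusFree⇒Basic-dropConstants ψ pf , PlusFree⇒Basic-dropConstants χ qf
  PlusFree⇒Basic-dropConstants (K m)   _         = tt

  eval-constantFactor : ∀ {n} (B : Structure S n) ψ h →
    eval B h ψ ≡ constantFactor ψ * eval B h (dropConstants ψ)
  eval-constantFactor B (C φ L) h = sym (*-identityˡ _)
  eval-constantFactor B (P V ψ) h =
    sumOver-*ˡ (deduplicate _≟_ V) (constantFactor ψ) _ _ (eval-constantFactor B ψ) h
  eval-constantFactor B (E V ψ) h = eval-constantFactor B ψ h
  eval-constantFactor B (ψ ⊗ χ) h = trans
    (cong₂ _*_ (eval-constantFactor B ψ h) (eval-constantFactor B χ h))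
    (interchange (constantFactor ψ) _ (constantFactor χ) _)
  eval-constantFactor B (ψ ⊕ χ) h = sym (*-identityˡ _)
  eval-constantFactor B (K m)   h = sym (*-identityʳ m)

  card-free≤width : ∀ (ψ : SF S) → card (free ψ) ≤ width ψ
  card-free≤width (C φ L) = m≤m⊔n _ _
  card-free≤width (P V ψ) = m≤m⊔n _ _
  card-free≤width (E V ψ) = m≤m⊔n _ _
  card-free≤width (ψ ⊗ χ) = m≤m⊔n _ _
  card-free≤width (ψ ⊕ χ) = m≤m⊔n _ _
  card-free≤width (K m)   = ≤-refl

  constantPart : SF S → SF S
  constantPart ψ = E (free ψ) (K (constantFactor ψ))

  factorConstants : SF S → SF S
  factorConstants ψ = constantPart ψ ⊗ dropConstants ψ

  free-constantPart : ∀ ψ → free (constantPart ψ) ≡ free ψ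
  free-constantPart ψ = ++-identityʳ (free ψ)

  WF-factorConstants : ∀ ψ → WF ψ → WF (factorConstants ψ)
  WF-factorConstants ψ wf
    rewrite free-constantPart ψ | free-dropConstants ψ =
      (tt , (λ ()) , (λ ())) , WF-dropConstants ψ wf , ≐-refl (free ψ) , (λ ())

  width-factorConstants : ∀ ψ → width (factorConstants ψ) ≤ width ψ
  width-factorConstants ψ
    rewrite free-constantPart ψ | width-dropConstants ψ =
      ⊔-lub (card-free≤width ψ) (⊔-lub (⊔-lub (card-free≤width ψ) z≤n) ≤-refl)

  LogEquiv-factorConstants : ∀ ψ → LogEquiv ψ (factorConstants ψ)
  LogEquiv-factorConstants ψ
    rewrite free-constantPart ψ =
      ≐-refl (free ψ) , λ n B h → eval-constantFactor B ψ h

lemmaC5 : (S : Signature) → Σ (SF S → SF S) λ alg →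
    (φ : SF S) → WF φ → PlusFree φ → SharpPP φ →
      Σ (SF S) λ ψ₁ → Σ (SF S) λ ψ₂ →
        (alg φ ≡ (ψ₁ ⊗ ψ₂)) × WF (alg φ) × SharpPP (alg φ)
        × Constant ψ₁ × Basic ψ₂
        × LogEquiv φ (alg φ) × (width (alg φ) ≤ width φ)
lemmaC5 S = factorConstants , λ φ wf pf pp →
  constantPart φ , dropConstants φ , refl
  , WF-factorConstants φ wf
  , (tt , SharpPP-dropConstants φ pp)
  , tt , PlusFree⇒Basic-dropConstants φ pf
  , LogEquiv-factorConstants φ
  , width-factorConstants φ
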